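{- For every formula $\phi\in{\cal L}^C_{\cal G}$, $\phi$ is satisfiable in ${\cal M}^{rt}_{\cal A}$ iff $\phi^{\sigma_2}$ is satisfiable in ${\cal M}^{rt}_{{\cal A}_1+{\cal A}_2}$.
   Context: ${\cal A}$ is a (possibly infinite) set of agents, ${\cal G}$ a set of nonempty subsets of ${\cal A}$, ${\cal L}^C_{\cal G}$ the language built from primitive propositions with $\wedge,\neg$, $K_i$ ($i\in{\cal A}$), $E_G,C_G$ ($G\in{\cal G}$), with $K_i$ identified with $E_{\{i\}}$. Semantics: $(M,s)\models K_i\phi$ iff $\phi$ holds at all ${\cal K}_i$-successors; $E_G\phi$ iff $K_i\phi$ for all $i\in G$; $C_G\phi$ iff $E^k_G\phi$ for all $k\ge1$. ${\cal M}^{rt}_{\cal A}$ is the class of structures over ${\cal A}$ with all ${\cal K}_i$ reflexive and transitive. ${\cal G}_\phi$ is the set of $G$ with $E_G$ or $C_G$ occurring in $\phi$. For a set ${\cal J}$ of subsets: ${\cal J}^1_0={\cal J}$, ${\cal J}^1_{k+1}={\cal J}\cup\{G-\bigcup{\cal H}:G\in{\cal J},{\cal H}\subseteq{\cal J}^1_k\text{ finite},|G-\bigcup{\cal H}|\le1\}$, ${\cal J}^1=\bigcup_k{\cal J}^1_k$. For $G\in{\cal J}$, ${\cal H}\subseteq{\cal J}$ is $G$-maximal if $G-\bigcup{\cal H}\neq\emptyset$ and $G-((\bigcup{\cal H})\cup G')=\emptyset$ for all $G'\in{\cal J}-{\cal H}$; ${\cal R}({\cal J})=\{(G,{\cal H}):G\in{\cal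 J},{\cal H}\ G\text{ -maximal}\}$. Let ${\cal A}^{\phi,rt}=\{{\cal H}:\exists G((G,{\cal H})\in{\cal R}({\cal G}^1_\phi))\}$; for ${\cal H}\in{\cal A}^{\phi,rt}$, $A_{\cal H}=G-\bigcup{\cal H}$ for any $G$ with $(G,{\cal H})\in{\cal R}({\cal G}^1_\phi)$ (independent of $G$). ${\cal A}_1=\{{\cal H}\in{\cal A}^{\phi,rt}:|A_{\cal H}|=1\}$, ${\cal A}_2={\cal A}^{\phi,rt}-{\cal A}_1$. $\sigma_2(i)={\cal H}$ if $i\in A_{\cal H}$, undefined otherwise; $\sigma_2(G)=\{\sigma_2(i):i\in G,\sigma_2(i)\text{ defined}\}$; $\phi^{\sigma_2}$ replaces each $E_G$, $C_G$ in $\phi$ (including $K_i=E_{\{i\}}$) by $E_{\sigma_2(G)}$, $C_{\sigma_2(G)}$. ${\cal M}^{rt}_{{\cal A}_1+{\cal A}_2}$ is the class of Kripke structures over agent set ${\cal A}_1\cup{\cal A}_2$ in which ${\cal K}_i$ is reflexive and transitive for $i\in{\cal A}_1$ and reflexive for $i\in{\cal A}_2$. -}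

module Defs where

open import Level using (Level; _⊔_; 0ℓ) renaming (suc to lsuc)
open import Data.Nat using (ℕ; zero; suc)
open import Data.Bool using (Bool; true)
open import Data.Empty using (⊥)
open import Data.Product using (Σ; ∃; ∃-syntax; _×_; _,_; proj₁)
open import Data.Sum using (_⊎_)
open import Data.List using (List; []; _∷_; _++_)
open import Data.List.Relation.Unary.All using (All)
open import Data.List.Relation.Unary.Any using (Any)
open import Relation.Nullary using (¬_)
open import Relation.Binary.PropositionalEquality using (_≡_)
open import Relation.Binary.Definitions using (Reflexive; Transitive)

-- K_i is identified with E_{i}, so there is no separate K constructor.

data Formula {a : Level} (A : Set a) (ℓ : Level) (Φ : Set) : Set (a ⊔ lsuc ℓ) where
  atom : Φ → Formula A ℓ Φ
  ¬'   : Formula A ℓ Φ → Formula A ℓ Φ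
  _∧'_ : Formula A ℓ Φ → Formula A ℓ Φ → Formula A ℓ Φ
  E    : (A → Set ℓ) → Formula A ℓ Φ → Formula A ℓ Φ
  C    : (A → Set ℓ) → Formula A ℓ Φ → Formula A ℓ Φ

record Structure {a : Level} (A : Set a) (Φ : Set) : Set (a ⊔ lsuc 0ℓ) where
  field
    State : Set
    𝒦     : A → State → State → Set
    π     : State → Φ → Bool
open Structure public

module _ {a ℓ : Level} {A : Set a} {Φ : Set} (M : Structure A Φ) where
  mutual
    _⊨_ : State M → Formula A ℓ Φ → Set (a ⊔ ℓ)
    s ⊨ atom p  = Level.Lift _ (π M s p ≡ true)
    s ⊨ ¬' φ    = ¬ (s ⊨ φ)
    s ⊨ (φ ∧' ψ) = (s ⊨ φ) × (s ⊨ ψ)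
    s ⊨ E G φ   = ∀ i → G i → ∀ t → 𝒦 M i s t → t ⊨ φ
    s ⊨ C G φ   = ∀ k → ⊨E^ (suc k) G φ s

    ⊨E^ : ℕ → (A → Set ℓ) → Formula A ℓ Φ → State M → Set (a ⊔ ℓ)
    ⊨E^ zero    G φ s = s ⊨ φ
    ⊨E^ (suc k) G φ s = ∀ i → G i → ∀ t → 𝒦 M i s t → ⊨E^ k G φ t

module _ {Agent : Set} {Φ : Set} where

  Grp : Set₁
  Grp = Agent → Set

  IsRT : Structure Agent Φ → Set
  IsRT M = ∀ i → Reflexive (𝒦 M i) × Transitive (𝒦 M i)

  SatRT : Formula Agent 0ℓ Φ → Set₁
  SatRT φ = Σ (Structure Agent Φ) λ M → IsRT M × ∃ λ s → _⊨_ M s φ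

  groups : Formula Agent 0ℓ Φ → List Grp
  groups (atom p) = []
  groups (¬' φ)   = groups φ
  groups (φ ∧' ψ) = groups φ ++ groups ψ
  groups (E G φ)  = G ∷ groups φ
  groups (C G φ)  = G ∷ groups φ

  GroupsNonempty : Formula Agent 0ℓ Φ → Set₁
  GroupsNonempty φ = All (λ G → ∃ λ i → G i) (groups φ)

  _≐_ : Grp → Grp → Set
  X ≐ Y = ∀ i → (X i → Y i) × (Y i → X i)

  _∈𝒢_ : Grp → Formula Agent 0ℓ Φ → Set₁
  X ∈𝒢 φ = Any (λ G → X ≐ G) (groups φ)

  ⋃ˡ : List Grp → Grp
  ⋃ˡ []       i = ⊥
  ⋃ˡ (X ∷ Xs) i = X i ⊎ ⋃ˡ Xs i

  _-⋃_ : Grp → List Grp → Grp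
  (G -⋃ Hs) i = G i × ¬ ⋃ˡ Hs i

  AtMostOne : ∀ {ℓ} → (Agent → Set ℓ) → Set ℓ
  AtMostOne S = ∀ i j → S i → S j → i ≡ j

  Singleton : ∀ {ℓ} → (Agent → Set ℓ) → Set ℓ
  Singleton S = ∃ λ i → S i × (∀ j → S j → j ≡ i)

  module _ (φ : Formula Agent 0ℓ Φ) where

    𝒢¹[_] : ℕ → Grp → Set₁
    𝒢¹[ zero ] X = X ∈𝒢 φ
    𝒢¹[ suc k ] X =
      X ∈𝒢 φ ⊎
      (∃ λ (G : Grp) → G ∈𝒢 φ × ∃ λ (Hs : List Grp) →
          All (𝒢¹[ k ]) Hs × X ≐ (G -⋃ Hs) × AtMostOne (G -⋃ Hs))

    𝒢¹ : Grp → Set₁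
    𝒢¹ X = ∃ λ k → 𝒢¹[ k ] X

    Fam : Set₁
    Fam = Grp → Set

    ⋃ : Fam → Agent → Set₁
    ⋃ H i = ∃ λ (X : Grp) → H X × X i

    Maximal : Grp → Fam → Set₁
    Maximal G H =
      (∃ λ i → G i × ¬ ⋃ H i) ×
      (∀ G' → 𝒢¹ G' → ¬ H G' → ¬ (∃ λ i → G i × ¬ (⋃ H i ⊎ G' i)))

    InR : Grp → Fam → Set₁
    InR G H = 𝒢¹ G × (∀ X → H X → 𝒢¹ X) × Maximal G H

    NewAgent : Set₁
    NewAgent = Σ Fam λ H → ∃ λ G → InR G H

    A_ : Fam → Agent → Set₁
    A_ H i = ∃ λ G → InR G H × G i × ¬ ⋃ H i

    -- agents of A^{φ,rt} are sets H: identify extensionally equal ones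
    _≈_ : NewAgent → NewAgent → Set₁
    (H , _) ≈ (H' , _) = ∀ X → (H X → H' X) × (H' X → H X)

    -- the class M^rt_{A_1 + A_2}: reflexive for all new agents, transitive
    -- for those in A_1 (|A_H| = 1); relations respect agent identity
    IsRT12 : Structure NewAgent Φ → Set₁
    IsRT12 M =
      (∀ a → Reflexive (𝒦 M a)) ×
      (∀ a → Singleton (A_ (proj₁ a)) → Transitive (𝒦 M a)) ×
      (∀ a b → a ≈ b → ∀ s t → 𝒦 M a s t → 𝒦 M b s t)

    SatRT12 : Formula NewAgent (lsuc 0ℓ) Φ → Set₁
    SatRT12 ψ = Σ (Structure NewAgent Φ) λ M → IsRT12 M × ∃ λ s → _⊨_ M s ψ

    -- σ_2(G) = { σ_2(i) : i ∈ G, σ_2(i) defined } = { H : ∃ i ∈ G, i ∈ A_H }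
    σ₂G : Grp → NewAgent → Set₁
    σ₂G G a = ∃ λ i → G i × A_ (proj₁ a) i

    _^σ₂ : Formula Agent 0ℓ Φ → Formula NewAgent (lsuc 0ℓ) Φ
    atom p ^σ₂   = atom p
    ¬' ψ ^σ₂     = ¬' (ψ ^σ₂)
    (ψ ∧' χ) ^σ₂ = (ψ ^σ₂) ∧' (χ ^σ₂)
    E G ψ ^σ₂    = E (σ₂G G) (ψ ^σ₂)
    C G ψ ^σ₂    = C (σ₂G G) (ψ ^σ₂)

module Submission where

-- Write k ≼ l when every set of (𝒢_φ)¹ containing k contains l.  The cell A_H of a new agent H
-- consists of ≼-equivalent agents, and every agent i of a group G lies above a ≼-minimal agent j
-- of G, whose cell belongs to σ₂(G).  Given an rt-structure, H moves along the relation of any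
-- agent above A_H, or only along that of its member when A_H is a singleton, so that H is
-- transitive there; this still serves every i above j because a singleton cell {j} forces j to be
-- isolated by a set of (𝒢_φ)¹, hence to be the only agent above j.  Isolation rests on a
-- finiteness argument: an agent first isolated at stage n is the only agent not isolated before n
-- in some difference G − ⋃Q of groups of φ, so finitely many sets of (𝒢_φ)¹ isolate every isolated
-- agent, and removing them together with the groups avoiding j from G leaves {j}.
-- Conversely, an (𝒜₁ + 𝒜₂)-structure unravels into paths labelled by old agents: members of
-- singleton cells follow arbitrary paths, every other agent a single step that cannot be chained.

open import Defs
import Level
open import Level using (0ℓ; Lift; lift)
open import Axiom.ExcludedMiddle using (ExcludedMiddle)
open import Axiom.DoubleNegationElimination using (em⇒dne)
open import Function.Base using (id; _∘_)
open import Function.Bundles using (_⇔_; mk⇔; Equivalence)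
open import Data.Bool using (true; false)
open import Data.Nat using (ℕ; zero; suc; _+_; _⊔_; _≤_; _<_; _≤′_; ≤′-refl; ≤′-step; z≤n; s≤s)
open import Data.Nat.Properties
  using (≤-refl; ≤-trans; ≤-pred; ≤-total; ≮⇒≥; ≤⇒≤′; <⇒≱; 1+n≰n; n<1+n; m≤m+n; m≤m⊔n; m≤n⊔m;
         +-mono-≤; +-mono-<-≤; +-mono-≤-<; +-monoʳ-≤; +-monoˡ-<; +-assoc; +-comm; module ≤-Reasoning)
open import Data.Empty using (⊥; ⊥-elim)
open import Data.Product using (∃; _×_; _,_; proj₁; proj₂)
import Data.Product as Product
open import Data.Sum using (_⊎_; inj₁; inj₂; [_,_])
import Data.Sum as Sum
open import Data.List using (List; []; _∷_; _++_; map; filter; concatMap; cartesianProduct)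
open import Data.List.Relation.Unary.All as All using (All; []; _∷_)
import Data.List.Relation.Unary.All.Properties as All
open import Data.List.Relation.Unary.Any using (Any; here; there)
open import Data.List.Membership.Propositional using (_∈_; find; lose)
open import Data.List.Membership.Propositional.Properties
  using (∈-++⁺ˡ; ∈-++⁺ʳ; ∈-++⁻; ∈-map⁺; ∈-filter⁺; ∈-filter⁻; ∈-concatMap⁺; ∈-concatMap⁻;
         ∈-cartesianProduct⁺)
open import Relation.Nullary using (¬_; Dec; yes; no; does)
open import Relation.Nullary.Decidable using (True; fromWitness; toWitness)
open import Relation.Unary using (Decidable)
open import Relation.Binary.Definitions using (Reflexive; Transitive)
open import Relation.Binary.PropositionalEquality using (_≡_; refl; sym; trans; cong; subst)
open import Relation.Binary.Construct.Closure.ReflexiveTransitive using (Star; ε; _◅_; _◅◅_; fold)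

sublists : ∀ {a} {A : Set a} → List A → List (List A)
sublists []       = [] ∷ []
sublists (x ∷ xs) = map (x ∷_) (sublists xs) ++ sublists xs

[]∈sublists : ∀ {a} {A : Set a} (xs : List A) → [] ∈ sublists xs
[]∈sublists []       = here refl
[]∈sublists (x ∷ xs) = ∈-++⁺ʳ (map (x ∷_) (sublists xs)) ([]∈sublists xs)

filter∈sublists : ∀ {a p} {A : Set a} {P : A → Set p} (P? : Decidable P) xs →
                  filter P? xs ∈ sublists xs
filter∈sublists P? []       = here refl
filter∈sublists P? (x ∷ xs) with does (P? x)
... | true  = ∈-++⁺ˡ (∈-map⁺ (x ∷_) (filter∈sublists P? xs))
... | false = ∈-++⁺ʳ (map (x ∷_) (sublists xs)) (filter∈sublists P? xs)

double+bit-<ˡ : ∀ {a c x y} → a < c → x ≤ 1 → a + a + x < c + c + y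
double+bit-<ˡ {a} {c} {x} {y} a<c x≤1 = begin-strict
  a + a + x     ≤⟨ +-monoʳ-≤ (a + a) x≤1 ⟩
  a + a + 1     ≡⟨ +-assoc a a 1 ⟩
  a + (a + 1)   ≡⟨ cong (a +_) (+-comm a 1) ⟩
  a + suc a     <⟨ +-monoˡ-< (suc a) (n<1+n a) ⟩
  suc a + suc a ≤⟨ +-mono-≤ a<c a<c ⟩
  c + c         ≤⟨ m≤m+n (c + c) y ⟩
  c + c + y     ∎
  where open ≤-Reasoning

double+bit-<ʳ : ∀ {a c x y} → a ≤ c → x < y → a + a + x < c + c + y
double+bit-<ʳ a≤c = +-mono-≤-< (+-mono-≤ a≤c a≤c)

□ : ∀ {a ℓ p} {A : Set a} {Φ : Set} (M : Structure A Φ) →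
    (A → Set ℓ) → (State M → Set p) → State M → Set (a Level.⊔ ℓ Level.⊔ p)
□ M G P s = ∀ i → G i → ∀ t → 𝒦 M i s t → P t

module _ {Agent Φ : Set} where

  ≐-refl : ∀ {X : Agent → Set} → _≐_ {Φ = Φ} X X
  ≐-refl i = id , id

  ⋃ˡ⁺ : ∀ {X : Agent → Set} {Xs i} → X ∈ Xs → X i → ⋃ˡ {Φ = Φ} Xs i
  ⋃ˡ⁺ (here refl) Xi = inj₁ Xi
  ⋃ˡ⁺ (there X∈)  Xi = inj₂ (⋃ˡ⁺ X∈ Xi)

  ⋃ˡ⁻ : ∀ {Xs : List (Agent → Set)} {i} → ⋃ˡ {Φ = Φ} Xs i → ∃ λ X → X ∈ Xs × X i
  ⋃ˡ⁻ {_ ∷ _}  (inj₁ Xi) = _ , here refl , Xi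
  ⋃ˡ⁻ {_ ∷ Xs} (inj₂ u)  = let X , X∈ , Xi = ⋃ˡ⁻ {Xs} u in X , there X∈ , Xi

module Classical (em : ∀ {ℓ} → ExcludedMiddle ℓ) where

  dne : ∀ {ℓ} {P : Set ℓ} → ¬ ¬ P → P
  dne = em⇒dne em

  -- Accessibility relations live in Set; under excluded middle every proposition has a copy there.
  ∥_∥ : ∀ {ℓ} → Set ℓ → Set
  ∥ P ∥ = True (em {P = P})

  squash : ∀ {ℓ} {P : Set ℓ} → P → ∥ P ∥
  squash {P = P} = fromWitness {a? = em {P = P}}

  unsquash : ∀ {ℓ} {P : Set ℓ} → ∥ P ∥ → P
  unsquash {P = P} = toWitness {a? = em {P = P}}

  argmin : ∀ {a p} {A : Set a} (P : A → Set p) (m : A → ℕ) {x} → P x →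
           ∃ λ y → P y × (∀ z → P z → m y ≤ m z)
  argmin P m {x} Px = descend (m x) Px ≤-refl
    where
    descend : ∀ n {x} → P x → m x ≤ n → ∃ λ y → P y × (∀ z → P z → m y ≤ m z)
    descend zero    {x} Px mx≤0 = x , Px , λ _ _ → ≤-trans mx≤0 z≤n
    descend (suc n) {x} Px mx≤n with em {P = ∃ λ y → P y × m y < m x}
    ... | yes (y , Py , my<mx) = descend n Py (≤-pred (≤-trans my<mx mx≤n))
    ... | no none              = x , Px , λ z Pz → ≮⇒≥ λ mz<mx → none (z , Pz , mz<mx)

  𝟙 : ∀ {ℓ} {P : Set ℓ} → Dec P → ℕ
  𝟙 (yes _) = 1
  𝟙 (no _)  = 0

  𝟙≤1 : ∀ {ℓ} {P : Set ℓ} (P? : Dec P) → 𝟙 P? ≤ 1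
  𝟙≤1 (yes _) = s≤s z≤n
  𝟙≤1 (no _)  = z≤n

  𝟙-mono : ∀ {ℓ ℓ'} {P : Set ℓ} {Q : Set ℓ'} → (P → Q) →
           (P? : Dec P) (Q? : Dec Q) → 𝟙 P? ≤ 𝟙 Q?
  𝟙-mono P⇒Q (yes p) (yes _) = ≤-refl
  𝟙-mono P⇒Q (yes p) (no ¬q) = ⊥-elim (¬q (P⇒Q p))
  𝟙-mono P⇒Q (no _)  _       = z≤n

  𝟙-mono-< : ∀ {ℓ ℓ'} {P : Set ℓ} {Q : Set ℓ'} → ¬ P → Q →
             (P? : Dec P) (Q? : Dec Q) → 𝟙 P? < 𝟙 Q?
  𝟙-mono-< ¬p q (yes p) _       = ⊥-elim (¬p p)
  𝟙-mono-< ¬p q (no _)  (yes _) = s≤s z≤n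
  𝟙-mono-< ¬p q (no _)  (no ¬q) = ⊥-elim (¬q q)

  count : ∀ {a} {A : Set a} → (A → Set) → List A → ℕ
  count P []       = 0
  count P (x ∷ xs) = 𝟙 (em {P = P x}) + count P xs

  count-mono : ∀ {a} {A : Set a} {P Q : A → Set} xs →
               (∀ {x} → x ∈ xs → P x → Q x) → count P xs ≤ count Q xs
  count-mono []       P⇒Q = z≤n
  count-mono (x ∷ xs) P⇒Q =
    +-mono-≤ (𝟙-mono (P⇒Q (here refl)) em em) (count-mono xs (P⇒Q ∘ there))

  count-mono-< : ∀ {a} {A : Set a} {P Q : A → Set} xs → (∀ {x} → x ∈ xs → P x → Q x) →
                 ∀ {x} → x ∈ xs → ¬ P x → Q x → count P xs < count Q xs
  count-mono-< (x ∷ xs) P⇒Q (here refl) ¬Px Qx =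
    +-mono-<-≤ (𝟙-mono-< ¬Px Qx em em) (count-mono xs (P⇒Q ∘ there))
  count-mono-< (x ∷ xs) P⇒Q (there y∈) ¬Py Qy =
    +-mono-≤-< (𝟙-mono (P⇒Q (here refl)) em em) (count-mono-< xs (P⇒Q ∘ there) y∈ ¬Py Qy)

module Reduction {Agent Φ : Set} (em : ∀ {ℓ} → ExcludedMiddle ℓ) (φ : Formula Agent 0ℓ Φ) where
  open Classical em

  Group : Set₁
  Group = Agent → Set

  Groups : List Group
  Groups = groups φ

  𝒥 : Group → Set₁
  𝒥 = 𝒢¹ φ

  𝒥[_] : ℕ → Group → Set₁
  𝒥[ n ] = 𝒢¹[_] φ n

  Groups-∈𝒢 : ∀ {X} → X ∈ Groups → X ∈𝒢 φ
  Groups-∈𝒢 X∈ = lose X∈ (≐-refl {Φ = Φ})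

  ∈𝒢⇒𝒥 : ∀ {X} → X ∈𝒢 φ → 𝒥 X
  ∈𝒢⇒𝒥 X∈ = 0 , X∈

  𝒥[]-suc : ∀ {n X} → 𝒥[ n ] X → 𝒥[ suc n ] X
  𝒥[]-suc {zero}  X∈       = inj₁ X∈
  𝒥[]-suc {suc n} (inj₁ X∈) = inj₁ X∈
  𝒥[]-suc {suc n} (inj₂ (G , G∈ , Hs , Hs∈ , X≐ , amo)) =
    inj₂ (G , G∈ , Hs , All.map 𝒥[]-suc Hs∈ , X≐ , amo)

  𝒥[]-mono : ∀ {m n X} → m ≤ n → 𝒥[ m ] X → 𝒥[ n ] X
  𝒥[]-mono m≤n = go (≤⇒≤′ m≤n)
    where
    go : ∀ {m n X} → m ≤′ n → 𝒥[ m ] X → 𝒥[ n ] X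
    go ≤′-refl        X∈ = X∈
    go (≤′-step m≤′n) X∈ = 𝒥[]-suc (go m≤′n X∈)

  𝒥-common-level : ∀ {Xs} → All 𝒥 Xs → ∃ λ N → All 𝒥[ N ] Xs
  𝒥-common-level []               = 0 , []
  𝒥-common-level ((n , X∈) ∷ Xs∈) =
    let N , Xs∈N = 𝒥-common-level Xs∈
    in  n ⊔ N , 𝒥[]-mono (m≤m⊔n n N) X∈ ∷ All.map (𝒥[]-mono (m≤n⊔m n N)) Xs∈N

  𝒥[]⇒group⊎atMostOne : ∀ {n X} → 𝒥[ n ] X → X ∈𝒢 φ ⊎ AtMostOne {Φ = Φ} X
  𝒥[]⇒group⊎atMostOne {zero}  X∈        = inj₁ X∈
  𝒥[]⇒group⊎atMostOne {suc n} (inj₁ X∈) = inj₁ X∈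
  𝒥[]⇒group⊎atMostOne {suc n} (inj₂ (_ , _ , _ , _ , X≐ , amo)) =
    inj₂ λ i k Xi Xk → amo i k (proj₁ (X≐ i) Xi) (proj₁ (X≐ k) Xk)

  _≼_ : Agent → Agent → Set₁
  k ≼ l = ∀ X → 𝒥 X → X k → X l

  ≼-refl : ∀ {k} → k ≼ k
  ≼-refl X _ Xk = Xk

  ≼-trans : ∀ {k l m} → k ≼ l → l ≼ m → k ≼ m
  ≼-trans k≼l l≼m X X∈ = l≼m X X∈ ∘ k≼l X X∈

  separating-set : ∀ {k l} → ¬ k ≼ l → ∃ λ X → 𝒥 X × X k × ¬ X l
  separating-set ¬k≼l = dne λ none → ¬k≼l λ X X∈ Xk → dne λ ¬Xl → none (X , X∈ , Xk , ¬Xl)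

  cell : NewAgent φ → Agent → Set₁
  cell a = A_ φ (proj₁ a)

  SingletonCell : NewAgent φ → Set₁
  SingletonCell a = Singleton {Φ = Φ} (cell a)

  cell-≼ : ∀ {H x y} → A_ φ H x → A_ φ H y → x ≼ y
  cell-≼ (_ , _ , _ , x∉) (_ , (_ , _ , _ , maximal) , Gy , y∉) X X∈ Xx =
    dne λ ¬Xy → maximal X X∈ (λ HX → x∉ (X , HX , Xx)) (_ , Gy , [ y∉ , ¬Xy ])

  family-char : ∀ {H x} X → A_ φ H x → H X ⇔ (𝒥 X × ¬ X x)
  family-char X (_ , (_ , H⊆𝒥 , _ , maximal) , Gx , x∉) = mk⇔
    (λ HX → H⊆𝒥 X HX , λ Xx → x∉ (X , HX , Xx))
    (λ (X∈ , ¬Xx) → dne λ ¬HX → maximal X X∈ ¬HX (_ , Gx , [ x∉ , ¬Xx ]))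

  cell-determines : ∀ a b {x} → cell a x → cell b x → _≈_ φ a b
  cell-determines a b xa xb X =
    Equivalence.from (family-char X xb) ∘ Equivalence.to (family-char X xa) ,
    Equivalence.from (family-char X xa) ∘ Equivalence.to (family-char X xb)

  ≈-sym : ∀ a b → _≈_ φ a b → _≈_ φ b a
  ≈-sym _ _ a≈b X = Product.swap (a≈b X)

  ⋃-mono : ∀ {H H'} → (∀ X → H X → H' X) → ∀ {i} → ⋃ φ H i → ⋃ φ H' i
  ⋃-mono H⊆H' (X , HX , Xi) = X , H⊆H' X HX , Xi

  InR-resp : ∀ {G H H'} → (∀ X → (H X → H' X) × (H' X → H X)) → InR φ G H → InR φ G H'
  InR-resp H≈H' (G∈ , H⊆𝒥 , (x , Gx , x∉) , maximal) =
    G∈ , (λ X → H⊆𝒥 X ∘ proj₂ (H≈H' X)) , (x , Gx , x∉ ∘ ⋃-mono (proj₂ ∘ H≈H')) ,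
    λ G' G'∈ ¬H'G' (z , Gz , z∉) →
      maximal G' G'∈ (¬H'G' ∘ proj₁ (H≈H' G')) (z , Gz , z∉ ∘ Sum.map₁ (⋃-mono (proj₁ ∘ H≈H')))

  cell-resp : ∀ a b → _≈_ φ a b → ∀ {i} → cell a i → cell b i
  cell-resp a b a≈b (G , inR , Gi , i∉) = G , InR-resp a≈b inR , Gi , i∉ ∘ ⋃-mono (proj₂ ∘ a≈b)

  SingletonCell-resp : ∀ a b → _≈_ φ a b → SingletonCell a → SingletonCell b
  SingletonCell-resp a b a≈b (x , x∈ , unique) =
    x , cell-resp a b a≈b x∈ , λ y → unique y ∘ cell-resp b a (≈-sym a b a≈b)

  -- Cells are nonempty by G-maximality.
  cell-nonempty : ∀ a → ∃ (cell a)
  cell-nonempty (H , G , inR@(_ , _ , (x , Gx , x∉) , _)) = x , G , inR , Gx , x∉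

  other-than : ∀ {S : Agent → Set₁} {x} → ¬ Singleton {Φ = Φ} S → S x →
               ∀ l → ∃ λ i → S i × ¬ l ≡ i
  other-than {x = x} ¬single Sx l with em {P = l ≡ x}
  ... | no l≢x   = x , Sx , l≢x
  ... | yes refl = dne λ none → ¬single (l , Sx , λ i Si → dne λ i≢l → none (i , Si , i≢l ∘ sym))

  Isolated : Agent → Set₁
  Isolated k = ∃ λ X → 𝒥 X × AtMostOne {Φ = Φ} X × X k

  groupCount : Agent → ℕ
  groupCount k = count (λ X → X k) Groups

  -- Lexicographic: first the number of groups of φ containing k, then whether k is isolated.
  rank : Agent → ℕ
  rank k = groupCount k + groupCount k + 𝟙 (em {P = Isolated k})

  rank-< : ∀ {k j X} → k ≼ j → 𝒥 X → X j → ¬ X k → rank k < rank j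
  rank-< {k} {j} {X} k≼j (n , X∈) Xj ¬Xk with 𝒥[]⇒group⊎atMostOne X∈
  ... | inj₁ X∈𝒢 =
    let G , G∈ , X≐G = find X∈𝒢
    in  double+bit-<ˡ
          (count-mono-< Groups groups-up G∈ (¬Xk ∘ proj₂ (X≐G k)) (proj₁ (X≐G j) Xj))
          (𝟙≤1 em)
    where
    groups-up : ∀ {Y} → Y ∈ Groups → Y k → Y j
    groups-up Y∈ = k≼j _ (∈𝒢⇒𝒥 (Groups-∈𝒢 Y∈))
  ... | inj₂ amo =
    double+bit-<ʳ (count-mono Groups (λ Y∈ → k≼j _ (∈𝒢⇒𝒥 (Groups-∈𝒢 Y∈))))
                  (𝟙-mono-< ¬isolated (X , (n , X∈) , amo , Xj) em em)
    where
    ¬isolated : ¬ Isolated k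
    ¬isolated (Y , Y∈ , amoY , Yk) = ¬Xk (subst X (amoY j k (k≼j Y Y∈ Yk) Yk) Xj)

  MinimalIn : Group → Agent → Set₁
  MinimalIn G j = G j × (∀ k → G k → k ≼ j → j ≼ k)

  minimal-below : ∀ {G i} → G i → ∃ λ j → MinimalIn G j × j ≼ i
  minimal-below {G} {i} Gi with argmin (λ k → G k × k ≼ i) rank (Gi , ≼-refl)
  ... | j , (Gj , j≼i) , least = j , (Gj , minimal) , j≼i
    where
    minimal : ∀ k → G k → k ≼ j → j ≼ k
    minimal k Gk k≼j X X∈ Xj =
      dne λ ¬Xk → <⇒≱ (rank-< k≼j X∈ Xj ¬Xk) (least k (Gk , ≼-trans k≼j j≼i))

  IsolatedAt : ℕ → Agent → Set₁
  IsolatedAt n k = ∃ λ X → 𝒥[ n ] X × AtMostOne {Φ = Φ} X × X k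

  IsolatedBefore : ℕ → Agent → Set₁
  IsolatedBefore zero    k = Lift _ ⊥
  IsolatedBefore (suc n) k = IsolatedAt n k

  IsolatedBefore-mono : ∀ {m n k} → m ≤ n → IsolatedBefore m k → IsolatedBefore n k
  IsolatedBefore-mono z≤n       (lift ())
  IsolatedBefore-mono (s≤s m≤n) (X , X∈ , amo , Xk) = X , 𝒥[]-mono m≤n X∈ , amo , Xk

  first-isolation : ∀ {k} → Isolated k → ∃ λ n → IsolatedAt n k × ¬ IsolatedBefore n k
  first-isolation {k} (X , (n , X∈) , amo , Xk)
    with argmin (λ n → IsolatedAt n k) id (X , X∈ , amo , Xk)
  ... | zero  , iso , _     = zero , iso , λ { (lift ()) }
  ... | suc n , iso , least = suc n , iso , λ earlier → 1+n≰n (least n earlier)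

  Determines : Group → List Group → Agent → ℕ → Set₁
  Determines G Q k n =
    _-⋃_ {Φ = Φ} G Q k × (∀ y → _-⋃_ {Φ = Φ} G Q y → ¬ IsolatedBefore n y → y ≡ k)

  DeterminedByDifference : Agent → ℕ → Set₁
  DeterminedByDifference k n = ∃ λ G → G ∈ Groups × ∃ λ Q → Q ∈ sublists Groups × Determines G Q k n

  determines-unique : ∀ {G Q k k' n n'} →
    Determines G Q k n → ¬ IsolatedBefore n k →
    Determines G Q k' n' → ¬ IsolatedBefore n' k' → k ≡ k'
  determines-unique {n = n} {n'} (k∈ , onlyK) ¬earlyK (k'∈ , onlyK') ¬earlyK' with ≤-total n n'
  ... | inj₁ n≤n' = sym (onlyK _ k'∈ (¬earlyK' ∘ IsolatedBefore-mono n≤n'))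
  ... | inj₂ n'≤n = onlyK' _ k∈ (¬earlyK ∘ IsolatedBefore-mono n'≤n)

  group-determines : ∀ {X k} → X ∈𝒢 φ → AtMostOne {Φ = Φ} X → X k → ∀ n → DeterminedByDifference k n
  group-determines {X} {k} X∈ amo Xk n =
    let G , G∈ , X≐G = find X∈
    in  G , G∈ , [] , []∈sublists Groups ,
        (proj₁ (X≐G k) Xk , λ ()) , λ y (Gy , _) _ → amo y k (proj₂ (X≐G y) Gy) Xk

  difference-determines : ∀ {n k G Hs} → G ∈𝒢 φ → All 𝒥[ n ] Hs →
    AtMostOne {Φ = Φ} (_-⋃_ {Φ = Φ} G Hs) → _-⋃_ {Φ = Φ} G Hs k → DeterminedByDifference k (suc n)
  difference-determines {n} {k} {G} {Hs} G∈ Hs∈ amo (Gk , k∉Hs) with find G∈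
  ... | G' , G'∈ , G≐G' =
    G' , G'∈ , Q , filter∈sublists matches? Groups , (proj₁ (G≐G' k) Gk , k∉Q) , only-k
    where
    matches? : Decidable (λ G₄ → Any (λ Y → _≐_ {Φ = Φ} Y G₄) Hs)
    matches? _ = em

    Q : List Group
    Q = filter matches? Groups

    k∉Q : ¬ ⋃ˡ {Φ = Φ} Q k
    k∉Q u =
      let G₄ , G₄∈Q , G₄k = ⋃ˡ⁻ u
          Y , Y∈ , Y≐G₄ = find (proj₂ (∈-filter⁻ matches? {xs = Groups} G₄∈Q))
      in  k∉Hs (⋃ˡ⁺ Y∈ (proj₂ (Y≐G₄ k) G₄k))

    only-k : ∀ y → _-⋃_ {Φ = Φ} G' Q y → ¬ IsolatedAt n y → y ≡ k
    only-k y (G'y , y∉Q) ¬iso = amo y k (proj₂ (G≐G' y) G'y , y∉Hs) (Gk , k∉Hs)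
      where
      y∉Hs : ¬ ⋃ˡ {Φ = Φ} Hs y
      y∉Hs u =
        let Y , Y∈ , Yy = ⋃ˡ⁻ u
            Y∈ₙ = All.lookup Hs∈ Y∈
        in  [ (λ Y∈𝒢 → let G₄ , G₄∈ , Y≐G₄ = find Y∈𝒢
                        in  y∉Q (⋃ˡ⁺ (∈-filter⁺ matches? G₄∈ (lose Y∈ Y≐G₄))
                                     (proj₁ (Y≐G₄ y) Yy)))
            , (λ amoY → ¬iso (Y , Y∈ₙ , amoY , Yy))
            ] (𝒥[]⇒group⊎atMostOne Y∈ₙ)

  isolated⇒determines : ∀ n {k} → IsolatedAt n k → DeterminedByDifference k n
  isolated⇒determines zero    (X , X∈ , amo , Xk)      = group-determines X∈ amo Xk zero
  isolated⇒determines (suc n) (X , inj₁ X∈ , amo , Xk) = group-determines X∈ amo Xk (suc n)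
  isolated⇒determines (suc n) (X , inj₂ (G , G∈ , Hs , Hs∈ , X≐ , amo) , _ , Xk) =
    difference-determines G∈ Hs∈ amo (proj₁ (X≐ _) Xk)

  FirstDetermined : Group → List Group → Set₁
  FirstDetermined G Q =
    ∃ λ k → ∃ λ n → ¬ IsolatedBefore n k × Determines G Q k n × IsolatedAt n k

  isolating-set : ∀ {G Q} → Dec (FirstDetermined G Q) → List Group
  isolating-set (yes (_ , _ , _ , _ , X , _)) = X ∷ []
  isolating-set (no _)                        = []

  differences : List (Group × List Group)
  differences = cartesianProduct Groups (sublists Groups)

  isolating-set-of : Group × List Group → List Group
  isolating-set-of (G , Q) = isolating-set (em {P = FirstDetermined G Q})

  isolating-sets : List Group
  isolating-sets = concatMap isolating-set-of differences

  isolating-sets-isolate : ∀ {X} → X ∈ isolating-sets → 𝒥 X × AtMostOne {Φ = Φ} X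
  isolating-sets-isolate X∈ =
    let _ , _ , X∈set = find (∈-concatMap⁻ isolating-set-of {xs = differences} X∈) in isolates em X∈set
    where
    isolates : ∀ {G Q X} (d : Dec (FirstDetermined G Q)) → X ∈ isolating-set d →
               𝒥 X × AtMostOne {Φ = Φ} X
    isolates (yes (_ , n , _ , _ , _ , X∈ , amo , _)) (here refl) = (n , X∈) , amo

  isolating-sets-cover : ∀ {k} → Isolated k → ⋃ˡ {Φ = Φ} isolating-sets k
  isolating-sets-cover {k} iso with first-isolation iso
  ... | n , isoₙ , ¬early with isolated⇒determines n isoₙ
  ... | G , G∈ , Q , Q∈ , det with covering (em {P = FirstDetermined G Q})
    where
    covering : (d : Dec (FirstDetermined G Q)) → ∃ λ X → X ∈ isolating-set d × X k
    covering (yes (k' , n' , ¬early' , det' , X , _ , _ , Xk')) =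
      X , here refl , subst X (determines-unique det' ¬early' det ¬early) Xk'
    covering (no none) = ⊥-elim (none (k , n , ¬early , det , isoₙ))
  ... | X , X∈set , Xk =
    ⋃ˡ⁺ (∈-concatMap⁺ isolating-set-of (lose (∈-cartesianProduct⁺ G∈ Q∈) X∈set)) Xk

  alone⇒isolated : ∀ {G j} → G ∈𝒢 φ → G j → (∀ k → G k → k ≼ j → k ≡ j) → Isolated j
  alone⇒isolated {G} {j} G∈ Gj alone with em {P = Isolated j}
  ... | yes iso  = iso
  ... | no ¬iso  =
    G∖Hs , (suc N , inj₂ (G , G∈ , Hs , Hs∈N , ≐-refl {Φ = Φ} , only-j)) , only-j , (Gj , j∉Hs)
    where
    avoids? : Decidable (λ X → ¬ X j)
    avoids? _ = em

    avoiding : List Group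
    avoiding = filter avoids? Groups

    Hs : List Group
    Hs = avoiding ++ isolating-sets

    G∖Hs : Group
    G∖Hs = _-⋃_ {Φ = Φ} G Hs

    Hs∈𝒥 : All 𝒥 Hs
    Hs∈𝒥 = All.tabulate λ X∈ →
      [ (λ X∈a → ∈𝒢⇒𝒥 (Groups-∈𝒢 (proj₁ (∈-filter⁻ avoids? {xs = Groups} X∈a))))
      , proj₁ ∘ isolating-sets-isolate
      ] (∈-++⁻ avoiding X∈)

    N : ℕ
    N = proj₁ (𝒥-common-level Hs∈𝒥)

    Hs∈N : All 𝒥[ N ] Hs
    Hs∈N = proj₂ (𝒥-common-level Hs∈𝒥)

    j∉Hs : ¬ ⋃ˡ {Φ = Φ} Hs j
    j∉Hs u =
      let X , X∈ , Xj = ⋃ˡ⁻ u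
      in  [ (λ X∈a → proj₂ (∈-filter⁻ avoids? {xs = Groups} X∈a) Xj)
          , (λ X∈i → let X∈𝒥 , amo = isolating-sets-isolate X∈i in ¬iso (X , X∈𝒥 , amo , Xj))
          ] (∈-++⁻ avoiding X∈)

    separated⇒∈⋃Hs : ∀ {X y} → 𝒥 X → X y → ¬ X j → ⋃ˡ {Φ = Φ} Hs y
    separated⇒∈⋃Hs {X} {y} (n , X∈) Xy ¬Xj with 𝒥[]⇒group⊎atMostOne X∈
    ... | inj₁ X∈𝒢 =
      let G₄ , G₄∈ , X≐G₄ = find X∈𝒢
      in  ⋃ˡ⁺ (∈-++⁺ˡ (∈-filter⁺ avoids? G₄∈ (¬Xj ∘ proj₂ (X≐G₄ j)))) (proj₁ (X≐G₄ y) Xy)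
    ... | inj₂ amo =
      let Y , Y∈ , Yy = ⋃ˡ⁻ (isolating-sets-cover (X , (n , X∈) , amo , Xy))
      in  ⋃ˡ⁺ (∈-++⁺ʳ avoiding Y∈) Yy

    ∈G∖Hs⇒≡j : ∀ {y} → G∖Hs y → y ≡ j
    ∈G∖Hs⇒≡j {y} (Gy , y∉Hs) = dne λ y≢j →
      let X , X∈ , Xy , ¬Xj = separating-set (y≢j ∘ alone y Gy)
      in  y∉Hs (separated⇒∈⋃Hs X∈ Xy ¬Xj)

    only-j : AtMostOne {Φ = Φ} G∖Hs
    only-j y y' y∈ y'∈ = trans (∈G∖Hs⇒≡j y∈) (sym (∈G∖Hs⇒≡j y'∈))

  module MinimalCell {G j} (G∈ : G ∈𝒢 φ) (min : MinimalIn G j) where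
    family : Fam φ
    family X = ∥ 𝒥 X × ¬ X j ∥

    ≼j⇒∉⋃family : ∀ {k} → k ≼ j → ¬ ⋃ φ family k
    ≼j⇒∉⋃family k≼j (X , X∈ , Xk) = let X∈𝒥 , ¬Xj = unsquash X∈ in ¬Xj (k≼j X X∈𝒥 Xk)

    ∉⋃family⇒≼j : ∀ {k} → ¬ ⋃ φ family k → k ≼ j
    ∉⋃family⇒≼j k∉ X X∈ Xk = dne λ ¬Xj → k∉ (X , squash (X∈ , ¬Xj) , Xk)

    inR : InR φ G family
    inR = ∈𝒢⇒𝒥 G∈ , (λ X → proj₁ ∘ unsquash) , (j , proj₁ min , ≼j⇒∉⋃family ≼-refl) ,
          λ G' G'∈ G'∉ (z , Gz , z∉) →
            z∉ (inj₂ (proj₂ min z Gz (∉⋃family⇒≼j (z∉ ∘ inj₁)) G' G'∈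
                       (dne λ ¬G'j → G'∉ (squash (G'∈ , ¬G'j)))))

    agent : NewAgent φ
    agent = family , G , inR

    ≼j⇒∈cell : ∀ {k} → G k → k ≼ j → cell agent k
    ≼j⇒∈cell Gk k≼j = G , inR , Gk , ≼j⇒∉⋃family k≼j

    j∈cell : cell agent j
    j∈cell = ≼j⇒∈cell (proj₁ min) ≼-refl

    agent∈σ₂ : σ₂G φ G agent
    agent∈σ₂ = j , proj₁ min , j∈cell

    singleton⇒above≡ : SingletonCell agent → ∀ {i} → j ≼ i → i ≡ j
    singleton⇒above≡ (_ , _ , unique) {i} j≼i =
      let X , X∈ , amo , Xj = alone⇒isolated G∈ (proj₁ min) alone
      in  amo i j (j≼i X X∈ Xj) Xj
      where
      alone : ∀ k → G k → k ≼ j → k ≡ j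
      alone k Gk k≼j = trans (unique k (≼j⇒∈cell Gk k≼j)) (sym (unique j j∈cell))

  σ₂-nonempty : ∀ {G i} → G ∈𝒢 φ → G i → ∃ (σ₂G φ G)
  σ₂-nonempty G∈ Gi with minimal-below Gi
  ... | _ , min , _ = agent , agent∈σ₂
    where open MinimalCell G∈ min

  BoxTransfer : (M : Structure Agent Φ) (M' : Structure (NewAgent φ) Φ) → (State M → State M') → Set₂
  BoxTransfer M M' f = ∀ {G} → G ∈𝒢 φ → (P : State M → Set) (P' : State M' → Set₁) →
    (∀ s → P s ⇔ P' (f s)) → ∀ s → □ M G P s ⇔ □ M' (σ₂G φ G) P' (f s)

  truth : (M : Structure Agent Φ) (M' : Structure (NewAgent φ) Φ) (f : State M → State M') →
    (∀ s p → π M s p ≡ π M' (f s) p) → BoxTransfer M M' f →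
    ∀ ψ → All (_∈𝒢 φ) (groups ψ) → ∀ s → _⊨_ M s ψ ⇔ _⊨_ M' (f s) (_^σ₂ φ ψ)
  truth M M' f π≡ box = go
    where
    go : ∀ ψ → All (_∈𝒢 φ) (groups ψ) → ∀ s → _⊨_ M s ψ ⇔ _⊨_ M' (f s) (_^σ₂ φ ψ)
    go (atom p) _ s =
      mk⇔ (λ (lift v) → lift (trans (sym (π≡ s p)) v)) (λ (lift v) → lift (trans (π≡ s p) v))
    go (¬' ψ) ψ∈ s =
      let ih = go ψ ψ∈ s
      in  mk⇔ (λ ¬v → ¬v ∘ Equivalence.from ih) (λ ¬v → ¬v ∘ Equivalence.to ih)
    go (ψ ∧' χ) ψχ∈ s =
      let ihψ = go ψ (All.++⁻ˡ (groups ψ) ψχ∈) s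
          ihχ = go χ (All.++⁻ʳ (groups ψ) ψχ∈) s
      in  mk⇔ (Product.map (Equivalence.to ihψ) (Equivalence.to ihχ))
              (Product.map (Equivalence.from ihψ) (Equivalence.from ihχ))
    go (E G ψ) (G∈ ∷ ψ∈) = box G∈ _ _ (go ψ ψ∈)
    go (C G ψ) (G∈ ∷ ψ∈) s =
      mk⇔ (λ v k → Equivalence.to (iterate (suc k) s) (v k))
          (λ v k → Equivalence.from (iterate (suc k) s) (v k))
      where
      iterate : ∀ k s → ⊨E^ M k G ψ s ⇔ ⊨E^ M' k (σ₂G φ G) (_^σ₂ φ ψ) (f s)
      iterate zero    = go ψ ψ∈
      iterate (suc k) = box G∈ _ _ (iterate k)

  groups-∈𝒢 : All (_∈𝒢 φ) Groups
  groups-∈𝒢 = All.tabulate Groups-∈𝒢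

  module Forward (M : Structure Agent Φ) (rt : IsRT M) where
    Reach : NewAgent φ → Agent → Set₁
    Reach a k = ∃ λ x → cell a x × x ≼ k × (SingletonCell a → k ≡ x)

    M' : Structure (NewAgent φ) Φ
    M' = record
      { State = State M
      ; 𝒦     = λ a s t → ∥ (∃ λ k → Reach a k × 𝒦 M k s t) ∥
      ; π     = π M
      }

    isRT12 : IsRT12 φ M'
    isRT12 = reflexive , transitive , respects
      where
      reflexive : ∀ a → Reflexive (𝒦 M' a)
      reflexive a =
        let x , x∈ = cell-nonempty a in squash (x , (x , x∈ , ≼-refl , λ _ → refl) , proj₁ (rt x))

      transitive : ∀ a → SingletonCell a → Transitive (𝒦 M' a)
      transitive a single@(_ , _ , unique) st tu
        with unsquash st | unsquash tu
      ... | k , reach@(x , x∈ , _ , k≡x) , k-st | k' , (x' , x'∈ , _ , k'≡x') , k'-tu =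
        squash (k , reach , proj₂ (rt k) k-st (subst (λ l → 𝒦 M l _ _) k'≡k k'-tu))
        where
        k'≡k : k' ≡ k
        k'≡k = trans (trans (k'≡x' single) (unique x' x'∈))
                     (sym (trans (k≡x single) (unique x x∈)))

      respects : ∀ a b → _≈_ φ a b → ∀ s t → 𝒦 M' a s t → 𝒦 M' b s t
      respects a b a≈b s t st with unsquash st
      ... | k , (x , x∈ , x≼k , k≡x) , k-st =
        squash (k , (x , cell-resp a b a≈b x∈ , x≼k , k≡x ∘ SingletonCell-resp b a (≈-sym a b a≈b)) ,
                k-st)

    box-transfer : BoxTransfer M M' id
    box-transfer {G} G∈ P P' P⇔P' s = mk⇔ to from
      where
      to : □ M G P s → □ M' (σ₂G φ G) P' s
      to □P a (x₀ , Gx₀ , x₀∈) t st with unsquash st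
      ... | k , (x , x∈ , x≼k , _) , k-st =
        Equivalence.to (P⇔P' t) (□P k (≼-trans (cell-≼ x₀∈ x∈) x≼k G (∈𝒢⇒𝒥 G∈) Gx₀) t k-st)

      from : □ M' (σ₂G φ G) P' s → □ M G P s
      from □P' i Gi t i-st with minimal-below Gi
      ... | j , min , j≼i =
        Equivalence.from (P⇔P' t) (□P' agent agent∈σ₂ t (squash (i , reach , i-st)))
        where
        open MinimalCell G∈ min
        reach : Reach agent i
        reach = j , j∈cell , j≼i , λ single → singleton⇒above≡ single j≼i

  module Backward (M' : Structure (NewAgent φ) Φ) (rt' : IsRT12 φ M') (s₀ : State M') where
    reflexive : ∀ a → Reflexive (𝒦 M' a)
    reflexive = proj₁ rt'

    transitive : ∀ a → SingletonCell a → Transitive (𝒦 M' a)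
    transitive = proj₁ (proj₂ rt')

    respects : ∀ a b → _≈_ φ a b → ∀ s t → 𝒦 M' a s t → 𝒦 M' b s t
    respects = proj₂ (proj₂ rt')

    Path : Set
    Path = List (Agent × State M')

    last : Path → State M'
    last []            = s₀
    last ((_ , t) ∷ _) = t

    EndsWith : Agent → Path → Set
    EndsWith i []            = ⊥
    EndsWith i ((l , _) ∷ _) = l ≡ i

    Step : Agent → Path → Path → Set₁
    Step i w w' = ∃ λ t → w' ≡ (i , t) ∷ w × ∃ λ a → cell a i × 𝒦 M' a (last w) t

    InSingletonCell : Agent → Set₁
    InSingletonCell i = ∃ λ a → cell a i × SingletonCell a

    Access : Agent → Path → Path → Set₁
    Access i w w' = (InSingletonCell i × Star (Step i) w w')
                  ⊎ (¬ InSingletonCell i × (w' ≡ w ⊎ (¬ EndsWith i w × Step i w w')))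

    M : Structure Agent Φ
    M = record { State = Path ; 𝒦 = λ i w w' → ∥ Access i w w' ∥ ; π = π M' ∘ last }

    isRT : IsRT M
    isRT i = (λ {w} → squash (access-refl w em)) , access-trans
      where
      access-refl : ∀ w → Dec (InSingletonCell i) → Access i w w
      access-refl w (yes single) = inj₁ (single , ε)
      access-refl w (no ¬single) = inj₂ (¬single , inj₁ refl)

      access-trans : Transitive (𝒦 M i)
      access-trans {w} {w'} {w''} p q
        with unsquash {P = Access i w w'} p | unsquash {P = Access i w' w''} q
      ... | inj₁ (single , path) | inj₁ (_ , path')     = squash (inj₁ (single , path ◅◅ path'))
      ... | inj₁ (single , _)    | inj₂ (¬single , _)   = ⊥-elim (¬single single)
      ... | inj₂ (¬single , _)   | inj₁ (single , _)    = ⊥-elim (¬single single)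
      ... | inj₂ (_ , inj₁ refl) | _                    = q
      ... | inj₂ _               | inj₂ (_ , inj₁ refl) = p
      ... | inj₂ (_ , inj₂ (_ , _ , refl , _)) | inj₂ (_ , inj₂ (fresh , _)) = ⊥-elim (fresh refl)

    path⇒𝒦 : ∀ {i a w w'} → cell a i → SingletonCell a → Star (Step i) w w' →
             𝒦 M' a (last w) (last w')
    path⇒𝒦 {i} {a} i∈a single =
      fold (λ w w' → 𝒦 M' a (last w) (last w')) (λ {w w' w''} → step {w} {w'} {w''}) (reflexive a)
      where
      step : ∀ {w w' w''} → Step i w w' → 𝒦 M' a (last w') (last w'') → 𝒦 M' a (last w) (last w'')
      step {w} {_} {w''} (t , refl , b , i∈b , b-st) =
        transitive a single {last w} {t} {last w''}
          (respects b a (cell-determines b a i∈b i∈a) _ _ b-st)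

    fresh-member : ∀ {a x} → ¬ SingletonCell a → cell a x → ∀ w → ∃ λ i → cell a i × ¬ EndsWith i w
    fresh-member {x = x} _ x∈ []              = x , x∈ , λ ()
    fresh-member ¬single x∈ ((l , _) ∷ _) = other-than ¬single x∈ l

    box-transfer : BoxTransfer M M' last
    box-transfer {G} G∈ P P' P⇔P' w = mk⇔ to from
      where
      to : □ M G P w → □ M' (σ₂G φ G) P' (last w)
      to □P a (x , Gx , x∈) t st with em {P = SingletonCell a}
      ... | yes single =
        Equivalence.to (P⇔P' _)
          (□P x Gx _ (squash (inj₁ ((a , x∈ , single) , (t , refl , a , x∈ , st) ◅ ε))))
      ... | no ¬single =
        let i , i∈ , fresh = fresh-member {a} ¬single x∈ w
            ¬singleᵢ : ¬ InSingletonCell i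
            ¬singleᵢ = λ (b , i∈b , single) →
              ¬single (SingletonCell-resp b a (cell-determines b a i∈b i∈) single)
        in  Equivalence.to (P⇔P' _)
              (□P i (cell-≼ x∈ i∈ G (∈𝒢⇒𝒥 G∈) Gx) _
                  (squash (inj₂ (¬singleᵢ , inj₂ (fresh , t , refl , a , i∈ , st)))))

      from : □ M' (σ₂G φ G) P' (last w) → □ M G P w
      from □P' i Gi w' iw' with unsquash {P = Access i w w'} iw'
      ... | inj₁ ((a , i∈a , single) , path) =
        Equivalence.from (P⇔P' w') (□P' a (i , Gi , i∈a) _ (path⇒𝒦 i∈a single path))
      ... | inj₂ (_ , inj₁ refl) =
        let a , a∈σ₂ = σ₂-nonempty G∈ Gi in Equivalence.from (P⇔P' w) (□P' a a∈σ₂ _ (reflexive a))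
      ... | inj₂ (_ , inj₂ (_ , t , refl , b , i∈b , b-st)) =
        Equivalence.from (P⇔P' w') (□P' b (i , Gi , i∈b) t b-st)

proposition4p8 : (∀ {ℓ} → ExcludedMiddle ℓ) →
    {Agent Φ : Set} (φ : Formula Agent 0ℓ Φ) →
    GroupsNonempty φ →
    SatRT φ ⇔ SatRT12 φ (_^σ₂ φ φ)
proposition4p8 em φ _ = mk⇔
  (λ (M , rt , s , s⊨φ) → let open Forward M rt in
     M' , isRT12 , s , Equivalence.to (truth M M' id (λ _ _ → refl) box-transfer φ groups-∈𝒢 s) s⊨φ)
  (λ (M' , rt' , s , s⊨φ) → let open Backward M' rt' s in
     M , isRT , [] ,
     Equivalence.from (truth M M' last (λ _ _ → refl) box-transfer φ groups-∈𝒢 []) s⊨φ)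
  where open Reduction em φ
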